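{- Let $\alpha=3+2\sqrt{2}$, $\beta=3-2\sqrt{2}$, and for integers $n\ge 0$ define $T_n=\frac{\alpha^n-\beta^n}{4\sqrt{2}}$ and $L_n=\alpha^n+\beta^n$. Then for every integer $n\ge 0$, $$(T_{2n+1}-1)T_{n+1}=T_nT_{2n+2}=\frac{L_{3n+2}-L_{n+2}}{32}.$$ -}

module Defs where

open import Data.Nat using (ℕ; zero; suc)
open import Data.Integer using (ℤ; +_; _+_; _*_; -_; _-_)

-- The ring ℤ[√2]: an element ⟨ a , b ⟩ represents a + b√2.
record ℤ√2 : Set where
  constructor ⟨_,_⟩
  field
    re : ℤ
    ir : ℤ
open ℤ√2 public

infixl 6 _⊕_ _⊖_
infixl 7 _⊗_

_⊕_ : ℤ√2 → ℤ√2 → ℤ√2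
⟨ a , b ⟩ ⊕ ⟨ c , d ⟩ = ⟨ a + c , b + d ⟩

_⊖_ : ℤ√2 → ℤ√2 → ℤ√2
⟨ a , b ⟩ ⊖ ⟨ c , d ⟩ = ⟨ a - c , b - d ⟩

-- (a + b√2)(c + d√2) = (ac + 2bd) + (ad + bc)√2
_⊗_ : ℤ√2 → ℤ√2 → ℤ√2
⟨ a , b ⟩ ⊗ ⟨ c , d ⟩ = ⟨ a * c + (+ 2) * (b * d) , a * d + b * c ⟩

one√2 : ℤ√2
one√2 = ⟨ + 1 , + 0 ⟩

_^√_ : ℤ√2 → ℕ → ℤ√2
x ^√ zero  = one√2
x ^√ suc n = x ⊗ (x ^√ n)

ι : ℤ → ℤ√2
ι a = ⟨ a , + 0 ⟩

α : ℤ√2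
α = ⟨ + 3 , + 2 ⟩

β : ℤ√2
β = ⟨ + 3 , - (+ 2) ⟩

four√2 : ℤ√2
four√2 = ⟨ + 0 , + 4 ⟩

-- T n = (αⁿ - βⁿ)/(4√2), stated division-free: T n · 4√2 = αⁿ - βⁿ
IsT : (ℕ → ℤ) → Set
IsT T = ∀ n → ι (T n) ⊗ four√2 ≡ (α ^√ n) ⊖ (β ^√ n)
  where open import Relation.Binary.PropositionalEquality using (_≡_)

IsL : (ℕ → ℤ) → Set
IsL L = ∀ n → ι (L n) ≡ (α ^√ n) ⊕ (β ^√ n)
  where open import Relation.Binary.PropositionalEquality using (_≡_)

-- Write αⁿ = pₙ + tₙ√8, so that βⁿ = pₙ − tₙ√8, T = t and L = 2p, and (pₙ, tₙ) solves the
-- Pell equation p² − 8t² = 1.  Together with the addition formulas for p and t, the norm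
-- gives the "subtraction formulas" pⱼ t_{j+k} − tⱼ p_{j+k} = tₖ and
-- p_{j+2k} − pⱼ = 16 t_{j+k} tₖ.  The first, with k = 1, is the identity
-- (T_{2n+1} − 1)T_{n+1} = Tₙ T_{2n+2} after expanding T_{2n+1} and T_{2n+2}; the second, with
-- j = n + 2 and k = n, is L_{3n+2} − L_{n+2} = 32 Tₙ T_{2n+2}.
module Submission where

open import Defs
open import Data.Nat using (ℕ; suc; zero)
open import Data.Integer using (ℤ; +_; _*_; _-_; _+_; -_)
open import Data.Product using (_×_; _,_)
open import Relation.Binary.PropositionalEquality using (_≡_)
open Data.Nat using () renaming (_+_ to _+ℕ_; _*_ to _*ℕ_)
import Data.Integer.Properties as ℤ
import Data.Nat.Properties as ℕ
open import Data.Integer.Tactic.RingSolver using (solve-∀)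
import Data.Nat.Tactic.RingSolver as ℕ-Solver
open import Relation.Binary.PropositionalEquality using (refl; sym; trans; cong; cong₂; subst)
open Relation.Binary.PropositionalEquality.≡-Reasoning

conj : ℤ√2 → ℤ√2
conj ⟨ a , b ⟩ = ⟨ a , - b ⟩

conj-⊗ : ∀ x y → conj (x ⊗ y) ≡ conj x ⊗ conj y
conj-⊗ ⟨ a , b ⟩ ⟨ c , d ⟩ = cong₂ ⟨_,_⟩ (re-identity a b c d) (ir-identity a b c d)
  where
  re-identity : ∀ a b c d → a * c + + 2 * (b * d) ≡ a * c + + 2 * (- b * - d)
  re-identity = solve-∀
  ir-identity : ∀ a b c d → - (a * d + b * c) ≡ a * - d + - b * c
  ir-identity = solve-∀

conj-^√ : ∀ x n → conj (x ^√ n) ≡ conj x ^√ n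
conj-^√ x zero    = refl
conj-^√ x (suc n) = trans (conj-⊗ x (x ^√ n)) (cong (conj x ⊗_) (conj-^√ x n))

p t : ℕ → ℤ
p zero    = + 1
p (suc n) = + 3 * p n + + 8 * t n
t zero    = + 0
t (suc n) = p n + + 3 * t n

α^√-components : ∀ n → α ^√ n ≡ ⟨ p n , + 2 * t n ⟩
α^√-components zero    = refl
α^√-components (suc n) rewrite α^√-components n =
  cong₂ ⟨_,_⟩ (re-identity (p n) (t n)) (ir-identity (p n) (t n))
  where
  re-identity : ∀ a b → + 3 * a + + 2 * (+ 2 * (+ 2 * b)) ≡ + 3 * a + + 8 * b
  re-identity = solve-∀
  ir-identity : ∀ a b → + 3 * (+ 2 * b) + + 2 * a ≡ + 2 * (a + + 3 * b)
  ir-identity = solve-∀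

β^√-components : ∀ n → β ^√ n ≡ ⟨ p n , - (+ 2 * t n) ⟩
β^√-components n = begin
  β ^√ n          ≡⟨ sym (conj-^√ α n) ⟩
  conj (α ^√ n)   ≡⟨ cong conj (α^√-components n) ⟩
  ⟨ p n , - (+ 2 * t n) ⟩ ∎

IsT⇒≡t : ∀ {T} → IsT T → ∀ n → T n ≡ t n
IsT⇒≡t {T} isT n = ℤ.*-cancelˡ-≡ (+ 4) (T n) (t n) (begin
  + 4 * T n                          ≡⟨ ir-of-product (T n) ⟩
  ir (ι (T n) ⊗ four√2)              ≡⟨ cong ir (isT n) ⟩
  ir (α ^√ n ⊖ β ^√ n)               ≡⟨ cong₂ (λ x y → ir (x ⊖ y)) (α^√-components n) (β^√-components n) ⟩
  + 2 * t n - - (+ 2 * t n)          ≡⟨ ir-of-difference (t n) ⟩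
  + 4 * t n                          ∎)
  where
  ir-of-product : ∀ a → + 4 * a ≡ a * + 4 + + 0 * + 0
  ir-of-product = solve-∀
  ir-of-difference : ∀ a → + 2 * a - - (+ 2 * a) ≡ + 4 * a
  ir-of-difference = solve-∀

IsL⇒≡p+p : ∀ {L} → IsL L → ∀ n → L n ≡ p n + p n
IsL⇒≡p+p isL n = trans (cong re (isL n)) (cong₂ (λ x y → re (x ⊕ y)) (α^√-components n) (β^√-components n))

p-+ : ∀ m n → p (m +ℕ n) ≡ p m * p n + + 8 * (t m * t n)
t-+ : ∀ m n → t (m +ℕ n) ≡ p m * t n + t m * p n

p-+ zero n = identity (p n)
  where
  identity : ∀ a → a ≡ + 1 * a + + 8 * (+ 0 * + 0)
  identity = solve-∀
p-+ (suc m) n rewrite p-+ m n | t-+ m n = identity (p m) (t m) (p n) (t n)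
  where
  identity : ∀ a b c d → + 3 * (a * c + + 8 * (b * d)) + + 8 * (a * d + b * c)
                       ≡ (+ 3 * a + + 8 * b) * c + + 8 * ((a + + 3 * b) * d)
  identity = solve-∀

t-+ zero n = identity (p n) (t n)
  where
  identity : ∀ a b → b ≡ + 1 * b + + 0 * a
  identity = solve-∀
t-+ (suc m) n rewrite p-+ m n | t-+ m n = identity (p m) (t m) (p n) (t n)
  where
  identity : ∀ a b c d → a * c + + 8 * (b * d) + + 3 * (a * d + b * c)
                       ≡ (+ 3 * a + + 8 * b) * d + (a + + 3 * b) * c
  identity = solve-∀

pell : ∀ n → p n * p n - + 8 * (t n * t n) ≡ + 1
pell zero    = refl
pell (suc n) = trans (norm-invariant (p n) (t n)) (pell n)
  where
  norm-invariant : ∀ a b → (+ 3 * a + + 8 * b) * (+ 3 * a + + 8 * b) - + 8 * ((a + + 3 * b) * (a + + 3 * b))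
                         ≡ a * a - + 8 * (b * b)
  norm-invariant = solve-∀

t-subtraction : ∀ j k → p j * t (j +ℕ k) - t j * p (j +ℕ k) ≡ t k
t-subtraction j k = begin
  p j * t (j +ℕ k) - t j * p (j +ℕ k)
    ≡⟨ cong₂ (λ x y → p j * x - t j * y) (t-+ j k) (p-+ j k) ⟩
  p j * (p j * t k + t j * p k) - t j * (p j * p k + + 8 * (t j * t k))
    ≡⟨ identity (p j) (t j) (p k) (t k) ⟩
  (p j * p j - + 8 * (t j * t j)) * t k
    ≡⟨ cong (_* t k) (pell j) ⟩
  + 1 * t k
    ≡⟨ ℤ.*-identityˡ (t k) ⟩
  t k ∎
  where
  identity : ∀ a b c d → a * (a * d + b * c) - b * (a * c + + 8 * (b * d)) ≡ (a * a - + 8 * (b * b)) * d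
  identity = solve-∀

p-subtraction : ∀ j k → p (j +ℕ k) * p k - + 8 * (t (j +ℕ k) * t k) ≡ p j
p-subtraction j k = begin
  p (j +ℕ k) * p k - + 8 * (t (j +ℕ k) * t k)
    ≡⟨ cong₂ (λ x y → x * p k - + 8 * (y * t k)) (p-+ j k) (t-+ j k) ⟩
  (p j * p k + + 8 * (t j * t k)) * p k - + 8 * ((p j * t k + t j * p k) * t k)
    ≡⟨ identity (p j) (t j) (p k) (t k) ⟩
  p j * (p k * p k - + 8 * (t k * t k))
    ≡⟨ cong (p j *_) (pell k) ⟩
  p j * + 1
    ≡⟨ ℤ.*-identityʳ (p j) ⟩
  p j ∎
  where
  identity : ∀ a b c d → (a * c + + 8 * (b * d)) * c - + 8 * ((a * d + b * c) * d) ≡ a * (c * c - + 8 * (d * d))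
  identity = solve-∀

p-+-+-minus-p : ∀ j k → p (j +ℕ k +ℕ k) - p j ≡ + 16 * (t (j +ℕ k) * t k)
p-+-+-minus-p j k = begin
  p (j +ℕ k +ℕ k) - p j
    ≡⟨ cong₂ _-_ (p-+ (j +ℕ k) k) (sym (p-subtraction j k)) ⟩
  (p (j +ℕ k) * p k + + 8 * (t (j +ℕ k) * t k)) - (p (j +ℕ k) * p k - + 8 * (t (j +ℕ k) * t k))
    ≡⟨ identity (p (j +ℕ k) * p k) (t (j +ℕ k) * t k) ⟩
  + 16 * (t (j +ℕ k) * t k) ∎
  where
  identity : ∀ a b → (a + + 8 * b) - (a - + 8 * b) ≡ + 16 * b
  identity = solve-∀

t-product-identity : ∀ n → (t (suc (2 *ℕ n)) - + 1) * t (suc n) ≡ t n * t (2 *ℕ n +ℕ 2)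
t-product-identity n = begin
  (t (suc (2 *ℕ n)) - + 1) * t (suc n)
    ≡⟨ cong (λ m → (t m - + 1) * D) (index-odd n) ⟩
  (t (n +ℕ suc n) - + 1) * D
    ≡⟨ cong₂ (λ x y → (x - y) * D) (t-+ n (suc n)) (sym unimodular) ⟩
  (A * D + B * C - (A * D - B * C)) * D
    ≡⟨ identity A B C D ⟩
  B * (C * D + D * C)
    ≡⟨ cong (B *_) (sym (t-+ (suc n) (suc n))) ⟩
  t n * t (suc n +ℕ suc n)
    ≡⟨ cong (λ m → B * t m) (sym (index-even n)) ⟩
  t n * t (2 *ℕ n +ℕ 2) ∎
  where
  A = p n
  B = t n
  C = p (suc n)
  D = t (suc n)
  index-odd : ∀ n → suc (2 *ℕ n) ≡ n +ℕ suc n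
  index-odd = ℕ-Solver.solve-∀
  index-even : ∀ n → 2 *ℕ n +ℕ 2 ≡ suc n +ℕ suc n
  index-even = ℕ-Solver.solve-∀
  unimodular : A * D - B * C ≡ + 1
  unimodular = subst (λ m → p n * t m - t n * p m ≡ + 1) (ℕ.+-comm n 1) (t-subtraction n 1)
  identity : ∀ a b c d → (a * d + b * c - (a * d - b * c)) * d ≡ b * (c * d + d * c)
  identity = solve-∀

t-product-via-p : ∀ n → + 32 * (t n * t (2 *ℕ n +ℕ 2)) ≡ (p (3 *ℕ n +ℕ 2) + p (3 *ℕ n +ℕ 2)) - (p (n +ℕ 2) + p (n +ℕ 2))
t-product-via-p n = begin
  + 32 * (t n * t (2 *ℕ n +ℕ 2))
    ≡⟨ cong (λ m → + 32 * (t n * t m)) (index-middle n) ⟩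
  + 32 * (t n * t (n +ℕ 2 +ℕ n))
    ≡⟨ identity (t (n +ℕ 2 +ℕ n)) (t n) ⟩
  + 2 * (+ 16 * (t (n +ℕ 2 +ℕ n) * t n))
    ≡⟨ cong (+ 2 *_) (sym (p-+-+-minus-p (n +ℕ 2) n)) ⟩
  + 2 * (p (n +ℕ 2 +ℕ n +ℕ n) - p (n +ℕ 2))
    ≡⟨ cong (λ m → + 2 * (p m - p (n +ℕ 2))) (sym (index-top n)) ⟩
  + 2 * (p (3 *ℕ n +ℕ 2) - p (n +ℕ 2))
    ≡⟨ doubling (p (3 *ℕ n +ℕ 2)) (p (n +ℕ 2)) ⟩
  (p (3 *ℕ n +ℕ 2) + p (3 *ℕ n +ℕ 2)) - (p (n +ℕ 2) + p (n +ℕ 2)) ∎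
  where
  index-middle : ∀ n → 2 *ℕ n +ℕ 2 ≡ n +ℕ 2 +ℕ n
  index-middle = ℕ-Solver.solve-∀
  index-top : ∀ n → 3 *ℕ n +ℕ 2 ≡ n +ℕ 2 +ℕ n +ℕ n
  index-top = ℕ-Solver.solve-∀
  identity : ∀ u v → + 32 * (v * u) ≡ + 2 * (+ 16 * (u * v))
  identity = solve-∀
  doubling : ∀ x y → + 2 * (x - y) ≡ (x + x) - (y + y)
  doubling = solve-∀

mainTheorem7 : (T L : ℕ → ℤ) → IsT T → IsL L → ∀ n →
    ((T (suc (2 *ℕ n)) - + 1) * T (suc n) ≡ T n * T (2 *ℕ n +ℕ 2))
    × ((+ 32) * (T n * T (2 *ℕ n +ℕ 2)) ≡ L (3 *ℕ n +ℕ 2) - L (n +ℕ 2))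
mainTheorem7 T L isT isL n =
  trans (cong₂ (λ x y → (x - + 1) * y) (T≡t _) (T≡t _))
        (trans (t-product-identity n) (sym (cong₂ _*_ (T≡t n) (T≡t _))))
  , trans (cong (λ x → + 32 * x) (cong₂ _*_ (T≡t n) (T≡t _)))
          (trans (t-product-via-p n) (sym (cong₂ _-_ (L≡p+p _) (L≡p+p _))))
  where
  T≡t : ∀ m → T m ≡ t m
  T≡t = IsT⇒≡t isT
  L≡p+p : ∀ m → L m ≡ p m + p m
  L≡p+p = IsL⇒≡p+p isL
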